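{- Let $G$ be a connected finite simple graph containing none of the claw, the co-diamond, $2K_2$ as an induced subgraph, with $\alpha(G)=3$ and containing a triangle. Let $\{a,b,c\}$ be a stable set of size $3$ in $G$, and for distinct $x,y\in\{a,b,c\}$ let $S_{x,y}$ be the set of vertices outside $\{a,b,c\}$ adjacent to both $x$ and $y$. Then $G$ is a generalized pyramid with respect to $\{a,b,c\}$: each of $S_{a,b},S_{a,c},S_{b,c}$ induces a clique, and every vertex of one of these sets is adjacent to every vertex of each of the other two.
   Context: $\alpha(G)$ is the maximum size of a stable set in $G$. Claw $=K_{1,3}$; co-diamond $=$ one edge plus two isolated vertices; $2K_2$ is two disjoint edges. (In such a graph every vertex outside $\{a,b,c\}$ is adjacent to exactly two of $a,b,c$.) -}

module Defs where

open import Data.Nat using (ℕ)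
open import Data.Fin using (Fin; zero; suc)
open import Data.Bool using (Bool; true; false)
open import Data.Product using (Σ; _×_; ∃; ∃-syntax)
open import Relation.Nullary using (¬_)
open import Relation.Binary.PropositionalEquality using (_≡_; _≢_)
open import Function.Definitions using (Injective)

record Graph (n : ℕ) : Set where
  field
    adj    : Fin n → Fin n → Bool
    sym    : ∀ u v → adj u v ≡ adj v u
    irrefl : ∀ v → adj v v ≡ false
open Graph public

Adj : ∀ {n} → Graph n → Fin n → Fin n → Set
Adj G u v = adj G u v ≡ true

InducedSub : ∀ {k n} → Graph k → Graph n → Set
InducedSub {k} {n} H G =
  Σ (Fin k → Fin n) λ f → Injective _≡_ _≡_ f × (∀ i j → adj H i j ≡ adj G (f i) (f j))

data Walk {n} (G : Graph n) : Fin n → Fin n → Set where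
  here : ∀ {u} → Walk G u u
  step : ∀ {u v w} → Adj G u v → Walk G v w → Walk G u w

Connected : ∀ {n} → Graph n → Set
Connected G = ∀ u v → Walk G u v

StableOfSize : ∀ {n} → Graph n → ℕ → Set
StableOfSize {n} G k =
  Σ (Fin k → Fin n) λ f → Injective _≡_ _≡_ f × (∀ i j → ¬ Adj G (f i) (f j))

-- α(G) = k : there is a stable set of size k and none of size k+1
-- (every larger stable set contains one of size k+1).
AlphaEq : ∀ {n} → Graph n → ℕ → Set
AlphaEq G k = StableOfSize G k × ¬ StableOfSize G (ℕ.suc k)

HasTriangle : ∀ {n} → Graph n → Set
HasTriangle G = ∃[ x ] ∃[ y ] ∃[ z ] (Adj G x y × Adj G y z × Adj G x z)

clawAdj : Fin 4 → Fin 4 → Bool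
clawAdj zero (suc _) = true
clawAdj (suc _) zero = true
clawAdj _ _ = false

claw : Graph 4
claw = record { adj = clawAdj ; sym = s ; irrefl = r }
  where
  s : ∀ u v → clawAdj u v ≡ clawAdj v u
  s zero zero = _≡_.refl
  s zero (suc v) = _≡_.refl
  s (suc u) zero = _≡_.refl
  s (suc u) (suc v) = _≡_.refl
  r : ∀ v → clawAdj v v ≡ false
  r zero = _≡_.refl
  r (suc v) = _≡_.refl

coDiamondAdj : Fin 4 → Fin 4 → Bool
coDiamondAdj zero (suc zero) = true
coDiamondAdj (suc zero) zero = true
coDiamondAdj _ _ = false

twoK2Adj : Fin 4 → Fin 4 → Bool
twoK2Adj zero (suc zero) = true
twoK2Adj (suc zero) zero = true
twoK2Adj (suc (suc zero)) (suc (suc (suc zero))) = true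
twoK2Adj (suc (suc (suc zero))) (suc (suc zero)) = true
twoK2Adj _ _ = false

coDiamond : Graph 4
coDiamond = record { adj = coDiamondAdj ; sym = s ; irrefl = r }
  where
  s : ∀ u v → coDiamondAdj u v ≡ coDiamondAdj v u
  s zero zero = _≡_.refl
  s zero (suc zero) = _≡_.refl
  s zero (suc (suc v)) = _≡_.refl
  s (suc zero) zero = _≡_.refl
  s (suc (suc u)) zero = _≡_.refl
  s (suc zero) (suc zero) = _≡_.refl
  s (suc zero) (suc (suc v)) = _≡_.refl
  s (suc (suc u)) (suc zero) = _≡_.refl
  s (suc (suc u)) (suc (suc v)) = _≡_.refl
  r : ∀ v → coDiamondAdj v v ≡ false
  r zero = _≡_.refl
  r (suc zero) = _≡_.refl
  r (suc (suc v)) = _≡_.refl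

twoK2 : Graph 4
twoK2 = record { adj = twoK2Adj ; sym = s ; irrefl = r }
  where
  s : ∀ u v → twoK2Adj u v ≡ twoK2Adj v u
  s zero zero = _≡_.refl
  s zero (suc zero) = _≡_.refl
  s zero (suc (suc zero)) = _≡_.refl
  s zero (suc (suc (suc zero))) = _≡_.refl
  s (suc zero) zero = _≡_.refl
  s (suc zero) (suc zero) = _≡_.refl
  s (suc zero) (suc (suc zero)) = _≡_.refl
  s (suc zero) (suc (suc (suc zero))) = _≡_.refl
  s (suc (suc zero)) zero = _≡_.refl
  s (suc (suc zero)) (suc zero) = _≡_.refl
  s (suc (suc zero)) (suc (suc zero)) = _≡_.refl
  s (suc (suc zero)) (suc (suc (suc zero))) = _≡_.refl
  s (suc (suc (suc zero))) zero = _≡_.refl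
  s (suc (suc (suc zero))) (suc zero) = _≡_.refl
  s (suc (suc (suc zero))) (suc (suc zero)) = _≡_.refl
  s (suc (suc (suc zero))) (suc (suc (suc zero))) = _≡_.refl
  r : ∀ v → twoK2Adj v v ≡ false
  r zero = _≡_.refl
  r (suc zero) = _≡_.refl
  r (suc (suc zero)) = _≡_.refl
  r (suc (suc (suc zero))) = _≡_.refl

ClawCoDiamond2K2Free : ∀ {n} → Graph n → Set
ClawCoDiamond2K2Free G =
  ¬ InducedSub claw G × ¬ InducedSub coDiamond G × ¬ InducedSub twoK2 G

Stable3 : ∀ {n} → Graph n → Fin n → Fin n → Fin n → Set
Stable3 G a b c =
  a ≢ b × a ≢ c × b ≢ c × ¬ Adj G a b × ¬ Adj G a c × ¬ Adj G b c

S : ∀ {n} → Graph n → (a b c : Fin n) → (x y v : Fin n) → Set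
S G a b c x y v = v ≢ a × v ≢ b × v ≢ c × Adj G x v × Adj G y v

IsClique : ∀ {n} → Graph n → (Fin n → Set) → Set
IsClique G P = ∀ u v → P u → P v → u ≢ v → Adj G u v

Complete : ∀ {n} → Graph n → (Fin n → Set) → (Fin n → Set) → Set
Complete G P Q = ∀ u v → P u → Q v → Adj G u v

GeneralizedPyramid : ∀ {n} → Graph n → Fin n → Fin n → Fin n → Set
GeneralizedPyramid G a b c =
  IsClique G (S G a b c a b) × IsClique G (S G a b c a c) × IsClique G (S G a b c b c)
  × Complete G (S G a b c a b) (S G a b c a c)
  × Complete G (S G a b c a b) (S G a b c b c)
  × Complete G (S G a b c a c) (S G a b c b c)

-- 1. A common neighbour of a and b is not adjacent to c, otherwise it is
--    the centre of a claw with leaves a, b, c.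
-- 2. S_ab is complete to S_ac: a non-edge x y with x ∈ S_ab, y ∈ S_ac would
--    make the edges xb and yc an induced 2K2 (using 1 for x c and b y).
-- 3. S_ab is a clique: let u, v ∈ S_ab be non-adjacent and w a neighbour
--    of c (G is connected).  If w sees a, then w ∈ S_ac is complete to u, v
--    by 2, and w is the centre of a claw with leaves u, v, c; symmetrically
--    if w sees b.  Otherwise the edge wc with a, b is an induced co-diamond.
-- By symmetry of a, b, c these give all six conditions of a generalized
-- pyramid.
module Submission where

open import Data.Nat using (ℕ)
open import Data.Fin using (Fin; zero; suc)
open import Data.Bool using (true; false)
open import Data.Bool.Properties using (_≟_; ¬-not)
open import Data.Product using (_,_; ∃; proj₁; proj₂)
open import Data.Empty using (⊥; ⊥-elim)
open import Relation.Nullary using (¬_; Dec; yes; no)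
open import Relation.Nullary.Decidable using (decidable-stable)
open import Relation.Binary.PropositionalEquality
  using (_≡_; _≢_; refl; sym; trans; subst)
open import Defs hiding (sym)

module _ {n : ℕ} (G : Graph n) where

  adj-sym : ∀ {u v} → Adj G u v → Adj G v u
  adj-sym {u} {v} uv = trans (Graph.sym G v u) uv

  nonadj-sym : ∀ {u v} → ¬ Adj G u v → ¬ Adj G v u
  nonadj-sym ¬uv vu = ¬uv (adj-sym vu)

  adj⇒≢ : ∀ {u v} → Adj G u v → u ≢ v
  adj⇒≢ {u} uv refl with trans (sym (irrefl G u)) uv
  ... | ()

  separates : ∀ {w u v} → Adj G w u → ¬ Adj G w v → u ≢ v
  separates wu ¬wv refl = ¬wv wu

  byContradiction : ∀ {u v} → ¬ ¬ Adj G u v → Adj G u v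
  byContradiction {u} {v} = decidable-stable (adj G u v ≟ true)

  quad : Fin n → Fin n → Fin n → Fin n → Fin 4 → Fin n
  quad w x y z zero                   = w
  quad w x y z (suc zero)             = x
  quad w x y z (suc (suc zero))       = y
  quad w x y z (suc (suc (suc zero))) = z

  embed4 : (H : Graph 4) (w x y z : Fin n)
    → w ≢ x → w ≢ y → w ≢ z → x ≢ y → x ≢ z → y ≢ z
    → adj H zero (suc zero) ≡ adj G w x
    → adj H zero (suc (suc zero)) ≡ adj G w y
    → adj H zero (suc (suc (suc zero))) ≡ adj G w z
    → adj H (suc zero) (suc (suc zero)) ≡ adj G x y
    → adj H (suc zero) (suc (suc (suc zero))) ≡ adj G x z
    → adj H (suc (suc zero)) (suc (suc (suc zero))) ≡ adj G y z
    → InducedSub H G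
  embed4 H w x y z w≢x w≢y w≢z x≢y x≢z y≢z e₀₁ e₀₂ e₀₃ e₁₂ e₁₃ e₂₃ =
    f , injective , agree
    where
    f : Fin 4 → Fin n
    f = quad w x y z

    injective : ∀ {i j} → f i ≡ f j → i ≡ j
    injective {zero}                {zero}                _ = refl
    injective {suc zero}            {suc zero}            _ = refl
    injective {suc (suc zero)}      {suc (suc zero)}      _ = refl
    injective {suc (suc (suc zero))} {suc (suc (suc zero))} _ = refl
    injective {zero}                {suc zero}            e = ⊥-elim (w≢x e)
    injective {zero}                {suc (suc zero)}      e = ⊥-elim (w≢y e)
    injective {zero}                {suc (suc (suc zero))} e = ⊥-elim (w≢z e)
    injective {suc zero}            {suc (suc zero)}      e = ⊥-elim (x≢y e)
    injective {suc zero}            {suc (suc (suc zero))} e = ⊥-elim (x≢z e)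
    injective {suc (suc zero)}      {suc (suc (suc zero))} e = ⊥-elim (y≢z e)
    injective {suc zero}            {zero}                e = ⊥-elim (w≢x (sym e))
    injective {suc (suc zero)}      {zero}                e = ⊥-elim (w≢y (sym e))
    injective {suc (suc (suc zero))} {zero}                e = ⊥-elim (w≢z (sym e))
    injective {suc (suc zero)}      {suc zero}            e = ⊥-elim (x≢y (sym e))
    injective {suc (suc (suc zero))} {suc zero}            e = ⊥-elim (x≢z (sym e))
    injective {suc (suc (suc zero))} {suc (suc zero)}      e = ⊥-elim (y≢z (sym e))

    -- Both graphs are irreflexive and symmetric, so the six pairs suffice.
    diagonal : ∀ i → adj H i i ≡ adj G (f i) (f i)
    diagonal i = trans (irrefl H i) (sym (irrefl G (f i)))

    flipped : ∀ i j → adj H i j ≡ adj G (f i) (f j) → adj H j i ≡ adj G (f j) (f i)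
    flipped i j e = trans (Graph.sym H j i) (trans e (Graph.sym G (f i) (f j)))

    agree : ∀ i j → adj H i j ≡ adj G (f i) (f j)
    agree zero                   zero                   = diagonal zero
    agree (suc zero)             (suc zero)             = diagonal (suc zero)
    agree (suc (suc zero))       (suc (suc zero))       = diagonal (suc (suc zero))
    agree (suc (suc (suc zero))) (suc (suc (suc zero))) = diagonal (suc (suc (suc zero)))
    agree zero                   (suc zero)             = e₀₁
    agree zero                   (suc (suc zero))       = e₀₂
    agree zero                   (suc (suc (suc zero))) = e₀₃
    agree (suc zero)             (suc (suc zero))       = e₁₂
    agree (suc zero)             (suc (suc (suc zero))) = e₁₃
    agree (suc (suc zero))       (suc (suc (suc zero))) = e₂₃
    agree (suc zero)             zero                   = flipped zero (suc zero) e₀₁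
    agree (suc (suc zero))       zero                   = flipped zero (suc (suc zero)) e₀₂
    agree (suc (suc (suc zero))) zero                   = flipped zero (suc (suc (suc zero))) e₀₃
    agree (suc (suc zero))       (suc zero)             = flipped (suc zero) (suc (suc zero)) e₁₂
    agree (suc (suc (suc zero))) (suc zero)             = flipped (suc zero) (suc (suc (suc zero))) e₁₃
    agree (suc (suc (suc zero))) (suc (suc zero))       = flipped (suc (suc zero)) (suc (suc (suc zero))) e₂₃

  edge : ∀ {u v} → Adj G u v → true ≡ adj G u v
  edge = sym

  nonEdge : ∀ {u v} → ¬ Adj G u v → false ≡ adj G u v
  nonEdge ¬uv = sym (¬-not ¬uv)

  -- The stable triple may be reordered; these two swaps generate all orders.
  swap₁₂ : ∀ {a b c} → Stable3 G a b c → Stable3 G b a c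
  swap₁₂ (a≢b , a≢c , b≢c , ¬ab , ¬ac , ¬bc) =
    (λ e → a≢b (sym e)) , b≢c , a≢c , nonadj-sym ¬ab , ¬bc , ¬ac

  swap₂₃ : ∀ {a b c} → Stable3 G a b c → Stable3 G a c b
  swap₂₃ (a≢b , a≢c , b≢c , ¬ab , ¬ac , ¬bc) =
    a≢c , a≢b , (λ e → b≢c (sym e)) , ¬ac , ¬ab , nonadj-sym ¬bc

  neighbour : Connected G → ∀ {u v} → u ≢ v → ∃ λ w → Adj G u w
  neighbour conn {u} {v} u≢v with conn u v
  ... | here              = ⊥-elim (u≢v refl)
  ... | step {v = w} uw _ = w , uw

  module _ (free : ClawCoDiamond2K2Free G) where

    -- The forbidden patterns; each asks only for the distinctness that
    -- does not already follow from the prescribed (non-)adjacencies.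

    noClaw : ∀ {p q r s} → q ≢ r → q ≢ s → r ≢ s
      → Adj G p q → Adj G p r → Adj G p s
      → ¬ Adj G q r → ¬ Adj G q s → ¬ Adj G r s → ⊥
    noClaw {p} {q} {r} {s} q≢r q≢s r≢s pq pr ps ¬qr ¬qs ¬rs =
      proj₁ free (embed4 claw p q r s (adj⇒≢ pq) (adj⇒≢ pr) (adj⇒≢ ps) q≢r q≢s r≢s
        (edge pq) (edge pr) (edge ps) (nonEdge ¬qr) (nonEdge ¬qs) (nonEdge ¬rs))

    noCoDiamond : ∀ {x y z w} → z ≢ w → Adj G x y
      → ¬ Adj G x z → ¬ Adj G x w → ¬ Adj G y z → ¬ Adj G y w → ¬ Adj G z w → ⊥
    noCoDiamond {x} {y} {z} {w} z≢w xy ¬xz ¬xw ¬yz ¬yw ¬zw =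
      proj₁ (proj₂ free) (embed4 coDiamond x y z w (adj⇒≢ xy)
        (separates (adj-sym xy) ¬yz) (separates (adj-sym xy) ¬yw)
        (separates xy ¬xz) (separates xy ¬xw) z≢w
        (edge xy) (nonEdge ¬xz) (nonEdge ¬xw) (nonEdge ¬yz) (nonEdge ¬yw) (nonEdge ¬zw))

    no2K2 : ∀ {x y z w} → Adj G x y → Adj G z w
      → ¬ Adj G x z → ¬ Adj G x w → ¬ Adj G y z → ¬ Adj G y w → ⊥
    no2K2 {x} {y} {z} {w} xy zw ¬xz ¬xw ¬yz ¬yw =
      proj₂ (proj₂ free) (embed4 twoK2 x y z w (adj⇒≢ xy)
        (separates (adj-sym xy) ¬yz) (separates (adj-sym xy) ¬yw)
        (separates xy ¬xz) (separates xy ¬xw) (adj⇒≢ zw)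
        (edge xy) (nonEdge ¬xz) (nonEdge ¬xw) (nonEdge ¬yz) (nonEdge ¬yw) (edge zw))

    missesThird : ∀ {a b c} → Stable3 G a b c
      → ∀ {x} → Adj G a x → Adj G b x → ¬ Adj G c x
    missesThird (a≢b , a≢c , b≢c , ¬ab , ¬ac , ¬bc) ax bx cx =
      noClaw a≢b a≢c b≢c (adj-sym ax) (adj-sym bx) (adj-sym cx) ¬ab ¬ac ¬bc

    crossComplete : ∀ {a b c} → Stable3 G a b c
      → ∀ {x y} → Adj G a x → Adj G b x → Adj G a y → Adj G c y → Adj G x y
    crossComplete st@(_ , _ , _ , _ , _ , ¬bc) ax bx ay cy = byContradiction λ ¬xy →
      no2K2 (adj-sym bx) (adj-sym cy) ¬xy (nonadj-sym (missesThird st ax bx))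
        (missesThird (swap₂₃ st) ay cy) ¬bc

    -- A common neighbour w of a and c is adjacent to any two common
    -- neighbours u, v of a and b, so they cannot be non-adjacent (claw at w).
    noBridge : ∀ {a b c} → Stable3 G a b c → ∀ {u v w} → u ≢ v
      → Adj G a u → Adj G b u → Adj G a v → Adj G b v → ¬ Adj G u v
      → Adj G a w → Adj G c w → ⊥
    noBridge st@(_ , _ , _ , _ , ¬ac , _) u≢v au bu av bv ¬uv aw cw =
      noClaw u≢v (separates au ¬ac) (separates av ¬ac)
        (adj-sym (crossComplete st au bu aw cw)) (adj-sym (crossComplete st av bv aw cw))
        (adj-sym cw) ¬uv (nonadj-sym (missesThird st au bu)) (nonadj-sym (missesThird st av bv))

    commonClique : Connected G → ∀ {a b c} → Stable3 G a b c
      → ∀ {u v} → u ≢ v → Adj G a u → Adj G b u → Adj G a v → Adj G b v → Adj G u v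
    commonClique conn {a} {b} {c} st@(a≢b , a≢c , _ , ¬ab , ¬ac , ¬bc) {u} {v} u≢v au bu av bv =
      byContradiction λ ¬uv → excluded ¬uv (adj G w a ≟ true) (adj G w b ≟ true)
      where
      neighbourOfC : ∃ λ w → Adj G c w
      neighbourOfC = neighbour conn (λ e → a≢c (sym e))
      w : Fin n
      w = proj₁ neighbourOfC
      cw : Adj G c w
      cw = proj₂ neighbourOfC
      excluded : ¬ Adj G u v → Dec (Adj G w a) → Dec (Adj G w b) → ⊥
      excluded ¬uv (yes wa) _ = noBridge st u≢v au bu av bv ¬uv (adj-sym wa) cw
      excluded ¬uv (no _) (yes wb) =
        noBridge (swap₁₂ st) u≢v bu au bv av ¬uv (adj-sym wb) cw
      excluded ¬uv (no ¬wa) (no ¬wb) =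
        noCoDiamond a≢b (adj-sym cw) ¬wa ¬wb (nonadj-sym ¬ac) (nonadj-sym ¬bc) ¬ab

lemma11 : ∀ {n} (G : Graph n) → Connected G → ClawCoDiamond2K2Free G → AlphaEq G 3
    → HasTriangle G → (a b c : Fin n) → Stable3 G a b c
    → GeneralizedPyramid G a b c
lemma11 G conn free _ _ a b c st =
  cliqueAB , cliqueAC , cliqueBC , completeAB-AC , completeAB-BC , completeAC-BC
  where
  cliqueAB : IsClique G (S G a b c a b)
  cliqueAB _ _ (_ , _ , _ , au , bu) (_ , _ , _ , av , bv) u≢v =
    commonClique G free conn st u≢v au bu av bv
  cliqueAC : IsClique G (S G a b c a c)
  cliqueAC _ _ (_ , _ , _ , au , cu) (_ , _ , _ , av , cv) u≢v =
    commonClique G free conn (swap₂₃ G st) u≢v au cu av cv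
  cliqueBC : IsClique G (S G a b c b c)
  cliqueBC _ _ (_ , _ , _ , bu , cu) (_ , _ , _ , bv , cv) u≢v =
    commonClique G free conn (swap₂₃ G (swap₁₂ G st)) u≢v bu cu bv cv
  completeAB-AC : Complete G (S G a b c a b) (S G a b c a c)
  completeAB-AC _ _ (_ , _ , _ , ax , bx) (_ , _ , _ , ay , cy) =
    crossComplete G free st ax bx ay cy
  completeAB-BC : Complete G (S G a b c a b) (S G a b c b c)
  completeAB-BC _ _ (_ , _ , _ , ax , bx) (_ , _ , _ , by , cy) =
    crossComplete G free (swap₁₂ G st) bx ax by cy
  completeAC-BC : Complete G (S G a b c a c) (S G a b c b c)
  completeAC-BC _ _ (_ , _ , _ , ax , cx) (_ , _ , _ , by , cy) =
    crossComplete G free (swap₁₂ G (swap₂₃ G st)) cx ax cy by
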